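{- Let $\mathcal{F}$ be a filter on $\omega$. The game $\mathfrak{G}(\mathcal{F},[\omega]^{<\omega},\mathcal{F}^*)$ is equivalent to the game $\mathfrak{G}(\mathcal{F},\omega,\mathcal{F}^*)$ (a player has a winning strategy in one iff the same player has one in the other). Thus, in $\mathfrak{G}(\mathcal{F},[\omega]^{<\omega},\mathcal{F}^*)$: (1) player I has a winning strategy if and only if $\mathcal{F}$ is countably generated; (2) player II has a winning strategy if and only if $\mathcal{F}$ is not a +-Ramsey filter.
   Context: A filter on $\omega$ is a family $\mathcal{F}\subseteq\mathcal{P}(\omega)$ closed under finite intersections and supersets and containing all cofinite subsets of $\omega$. $\mathcal{F}^+=\{X\subseteq\omega: X\cap Y\text{ infinite for all }Y\in\mathcal{F}\}$, $\mathcal{F}^*=\mathcal{P}(\omega)\setminus\mathcal{F}^+$. In $\mathfrak{G}(\mathcal{F},\omega,\mathcal{F}^*)$, at each stage $k$ player I chooses $X_k\in\mathcal{F}$ and II responds with $n_k\in X_k$; II wins iff $\{n_k:k\in\omega\}\in\mathcal{F}^*$. In $\mathfrak{G}(\mathcal{F},[\omega]^{<\omega},\mathcal{F}^*)$, I chooses $X_k\in\mathcal{F}$ and II responds with a nonempty finite $s_k\subseteq X_k$; II wins iff $\bigcup_k s_k\in\mathcal{F}^*$. $\mathcal{F}$ is countably generated if it is generated by a countable family of sets. An $\mathcal{F}^+$-tree is a tree $\mathcal{T}$ of finite sequences of natural numbers (closed under initial segments) such that for each $\bar s\in\mathcal{T}$ there is $X_{\bar s}\in\mathcal{F}^+$ with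 $\bar s^\frown n\in\mathcal{T}$ for all $n\in X_{\bar s}$. $\mathcal{F}$ is +-Ramsey if every $\mathcal{F}^+$-tree has a branch (infinite sequence all of whose initial segments lie in $\mathcal{T}$) whose set of values lies in $\mathcal{F}^+$. -}

module Defs where

open import Level using (0ℓ)
open import Data.Nat using (ℕ; zero; suc; _≤_)
open import Data.List using (List; []; _∷_; _∷ʳ_; _++_)
open import Data.List.Relation.Unary.All using (All)
open import Data.List.Membership.Propositional using (_∈_)
open import Data.Product using (Σ; ∃; ∃-syntax; _×_; _,_)
open import Data.Empty using (⊥)
open import Data.Unit using (⊤)
open import Relation.Nullary using (¬_)
open import Relation.Binary.PropositionalEquality using (_≡_)

Subset : Set₁
Subset = ℕ → Set

∅ : Subset
∅ _ = ⊥

_⊆_ : Subset → Subset → Set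
A ⊆ B = ∀ m → A m → B m

_∩_ : Subset → Subset → Subset
(A ∩ B) m = A m × B m

Cofinite : Subset → Set
Cofinite A = ∃[ N ] (∀ m → N ≤ m → A m)

Infinite : Subset → Set
Infinite A = ∀ N → ∃[ m ] (N ≤ m × A m)

Family : Set₁
Family = Subset → Set

record IsFilter (F : Family) : Set₁ where
  field
    cofinite⊆ : ∀ A → Cofinite A → F A
    ∩-closed  : ∀ A B → F A → F B → F (A ∩ B)
    ⊇-closed  : ∀ A B → A ⊆ B → F A → F B
    proper    : ¬ F ∅

Plus : Family → Subset → Set₁
Plus F X = ∀ Y → F Y → Infinite (X ∩ Y)

Star : Family → Subset → Set₁
Star F X = ¬ Plus F X

⋂ : (ℕ → Subset) → List ℕ → Subset
⋂ g is m = All (λ i → g i m) is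

CountablyGenerated : Family → Set₁
CountablyGenerated F =
  Σ (ℕ → Subset) λ g →
    (∀ i → F (g i)) ×
    (∀ Y → F Y → Σ (List ℕ) λ is → Σ Subset λ C → Cofinite C × ((C ∩ ⋂ g is) ⊆ Y))

prefix : {A : Set₁} → (ℕ → A) → ℕ → List A
prefix f zero    = []
prefix f (suc k) = prefix f k ∷ʳ f k

prefixℕ : (ℕ → ℕ) → ℕ → List ℕ
prefixℕ f zero    = []
prefixℕ f (suc k) = prefixℕ f k ∷ʳ f k

prefixL : (ℕ → List ℕ) → ℕ → List (List ℕ)
prefixL f zero    = []
prefixL f (suc k) = prefixL f k ∷ʳ f k

range : (ℕ → ℕ) → Subset
range n m = ∃[ k ] (n k ≡ m)

⋃ : (ℕ → List ℕ) → Subset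
⋃ s m = ∃[ k ] (m ∈ s k)

-- The game 𝔊(F, ω, F*)
-- Player I's strategy: a function of II's previous moves.
-- Player II's strategy: a function of I's previous moves and I's current move.

IWinsPoints : Family → Set₁
IWinsPoints F =
  Σ (List ℕ → Subset) λ σ →
    (∀ h → F (σ h)) ×
    (∀ (n : ℕ → ℕ) → (∀ k → σ (prefixℕ n k) (n k)) → Plus F (range n))

IIWinsPoints : Family → Set₁
IIWinsPoints F =
  Σ (List Subset → Subset → ℕ) λ τ →
    (∀ prev X → All F prev → F X → X (τ prev X)) ×
    (∀ (X : ℕ → Subset) → (∀ k → F (X k)) →
       Star F (range (λ k → τ (prefix X k) (X k))))

-- The game 𝔊(F, [ω]^{<ω}, F*)  (finite sets represented by lists)

NonEmpty : List ℕ → Set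
NonEmpty [] = ⊥
NonEmpty (_ ∷ _) = ⊤

IWinsFinite : Family → Set₁
IWinsFinite F =
  Σ (List (List ℕ) → Subset) λ σ →
    (∀ h → F (σ h)) ×
    (∀ (s : ℕ → List ℕ) → (∀ k → NonEmpty (s k) × All (σ (prefixL s k)) (s k)) →
       Plus F (⋃ s))

IIWinsFinite : Family → Set₁
IIWinsFinite F =
  Σ (List Subset → Subset → List ℕ) λ τ →
    (∀ prev X → All F prev → F X → NonEmpty (τ prev X) × All X (τ prev X)) ×
    (∀ (X : ℕ → Subset) → (∀ k → F (X k)) →
       Star F (⋃ (λ k → τ (prefix X k) (X k))))

record PlusTree (F : Family) (T : List ℕ → Set) : Set₁ where
  field
    root      : T []
    initClosed : ∀ s t → T (s ++ t) → T s
    splitting : ∀ s → T s → Σ Subset λ X → Plus F X × (∀ n → X n → T (s ∷ʳ n))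

IsBranch : (List ℕ → Set) → (ℕ → ℕ) → Set
IsBranch T b = ∀ k → T (prefixℕ b k)

PlusRamsey : Family → Set₁
PlusRamsey F =
  ∀ (T : List ℕ → Set) → PlusTree F T →
    Σ (ℕ → ℕ) λ b → IsBranch T b × Plus F (range b)

-- A move of the point game is a singleton move of the finite-set game, so I's winning
-- strategies pass from the finite-set game to the point game and II's from the point game
-- to the finite-set game; the converse directions go through the two characterisations.
-- If σ wins the point game for I, the countably many sets σ(h) generate F: otherwise some
-- Y ∈ F contains no finite intersection of them, and II answers every σ(h) outside Y.
-- From generators gᵢ, I plays [k, ∞) ∩ g₀ ∩ ⋯ ∩ gₖ₋₁ at stage k.
-- A winning strategy τ of II in the finite-set game yields an F⁺-tree: a node splits at
-- every n that τ can play against some move of I, and the positions of I that realise a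
-- branch form a play in which τ covers the values of the branch, so no branch lies in F⁺.
-- Conversely, given an F⁺-tree without branch in F⁺, II wins the point game by answering
-- each move of I inside the splitting set of the current node.
module Submission where

open import Defs
open import Level using (suc; 0ℓ; lift; lower)
open import Axiom.ExcludedMiddle using (ExcludedMiddle)
open import Data.Product using (_×_; Σ; _,_; proj₁; proj₂)
open import Relation.Nullary using (¬_; Dec; yes; no)
open import Relation.Nullary.Decidable using (True; toWitness; fromWitness; map′)
open import Function.Bundles using (_⇔_; mk⇔)
open import Function using (_∘_)
open import Data.Nat using (ℕ; zero; _≤_; _<_; z≤n; _+_)
  renaming (suc to 1+)
open import Data.Nat.Properties using (+-suc; +-identityʳ; +-comm; ≤-trans; m≤m+n; m≤n+m; m<1+n⇒m<n∨m≡n)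
open import Data.List using (List; []; _∷_; _∷ʳ_; _++_; map; foldl; length)
open import Data.List.Properties using (map-++; foldl-∷ʳ; length-++)
open import Data.List.Relation.Unary.All using (All; []; _∷_)
open import Data.List.Relation.Unary.All.Properties using (∷ʳ⁺)
open import Data.List.Relation.Unary.Any using (here)
open import Data.List.Membership.Propositional using (_∈_)
open import Data.Empty using (⊥; ⊥-elim)
open import Data.Unit using (⊤; tt)
open import Data.Sum using (inj₁; inj₂)
open import Relation.Binary.PropositionalEquality using (_≡_; refl; sym; trans; cong; cong₂; subst)
open import Data.Nat.Binary as ℕᵇ using (ℕᵇ; 2[1+_]; 1+[2_])
open import Data.Nat.Binary.Properties using (fromℕ-toℕ)

-- The list a₀ ∷ a₁ ∷ ⋯ is coded by the bijective base-2 numeral (digits 1 and 2, least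
-- significant first) 1^a₀ 2 1^a₁ 2 ⋯ ; reading it back gives a surjection ℕ → List ℕ.
ones : ℕ → ℕᵇ → ℕᵇ
ones zero   x = x
ones (1+ a) x = 1+[2 ones a x ]

encode : List ℕ → ℕᵇ
encode []      = ℕᵇ.zero
encode (a ∷ l) = ones a 2[1+ encode l ]

decodeFrom : ℕ → ℕᵇ → List ℕ
decodeFrom acc ℕᵇ.zero  = []
decodeFrom acc 2[1+ x ] = acc ∷ decodeFrom 0 x
decodeFrom acc 1+[2 x ] = decodeFrom (1+ acc) x

decodeFrom-ones : ∀ a acc x → decodeFrom acc (ones a x) ≡ decodeFrom (a + acc) x
decodeFrom-ones zero   acc x = refl
decodeFrom-ones (1+ a) acc x =
  trans (decodeFrom-ones a (1+ acc) x) (cong (λ c → decodeFrom c x) (+-suc a acc))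

decodeFrom-encode : ∀ l → decodeFrom 0 (encode l) ≡ l
decodeFrom-encode []      = refl
decodeFrom-encode (a ∷ l) =
  trans (decodeFrom-ones a 0 _) (cong₂ _∷_ (+-identityʳ a) (decodeFrom-encode l))

code : List ℕ → ℕ
code = ℕᵇ.toℕ ∘ encode

decode : ℕ → List ℕ
decode = decodeFrom 0 ∘ ℕᵇ.fromℕ

decode-code : ∀ l → decode (code l) ≡ l
decode-code l = trans (cong (decodeFrom 0) (fromℕ-toℕ (encode l))) (decodeFrom-encode l)

Plus-mono : ∀ {F A B} → A ⊆ B → Plus F A → Plus F B
Plus-mono A⊆B A⁺ Y Y∈F N with A⁺ Y Y∈F N
... | m , N≤m , Am , Ym = m , N≤m , A⊆B m Am , Ym

singleton : ℕ → List ℕ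
singleton n = n ∷ []

⋃-singleton : ∀ n → ⋃ (singleton ∘ n) ⊆ range n
⋃-singleton n m (k , here m≡nk) = k , sym m≡nk

prefixL-∘ : ∀ (f : ℕ → List ℕ) n k → prefixL (f ∘ n) k ≡ map f (prefixℕ n k)
prefixL-∘ f n zero   = refl
prefixL-∘ f n (1+ k) =
  trans (cong (_∷ʳ f (n k)) (prefixL-∘ f n k)) (sym (map-++ f (prefixℕ n k) (n k ∷ [])))

length-prefixL : ∀ s k → length (prefixL s k) ≡ k
length-prefixL s zero   = refl
length-prefixL s (1+ k) =
  trans (length-++ (prefixL s k)) (trans (cong (_+ 1) (length-prefixL s k)) (+-comm k 1))

All-prefix : ∀ {P : Subset → Set} X → (∀ k → P (X k)) → ∀ k → All P (prefix X k)
All-prefix X PX zero   = []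
All-prefix X PX (1+ k) = ∷ʳ⁺ (All-prefix X PX k) (PX k)

NonEmpty-All⇒∃ : ∀ {P : ℕ → Set} l → NonEmpty l → All P l → Σ ℕ λ x → x ∈ l × P x
NonEmpty-All⇒∃ (x ∷ _) _ (px ∷ _) = x , here refl , px

Tail : ℕ → Subset
Tail N m = N ≤ m

history : (List ℕ → ℕ) → ℕ → List ℕ
history ρ zero   = []
history ρ (1+ k) = history ρ k ∷ʳ ρ (history ρ k)

prefixℕ-history : ∀ ρ k → prefixℕ (ρ ∘ history ρ) k ≡ history ρ k
prefixℕ-history ρ zero   = refl
prefixℕ-history ρ (1+ k) = cong (_∷ʳ ρ (history ρ k)) (prefixℕ-history ρ k)

meetBelow : (ℕ → Subset) → ℕ → Subset
meetBelow g k m = k ≤ m × (∀ i → i < k → g i m)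

strictBound : List ℕ → ℕ
strictBound []       = 0
strictBound (i ∷ is) = 1+ i + strictBound is

⋂-meetBelow : ∀ g is k m → strictBound is ≤ k → (∀ i → i < k → g i m) → ⋂ g is m
⋂-meetBelow g []       k m _ _ = []
⋂-meetBelow g (i ∷ is) k m bound≤k g<k =
  g<k i (≤-trans (m≤m+n (1+ i) (strictBound is)) bound≤k) ∷
  ⋂-meetBelow g is k m (≤-trans (m≤n+m (strictBound is) (1+ i)) bound≤k) g<k

meetBelow-⊆ : ∀ g is N → meetBelow g (N + strictBound is) ⊆ (Tail N ∩ ⋂ g is)
meetBelow-⊆ g is N m (K≤m , m∈g) =
  ≤-trans (m≤m+n N (strictBound is)) K≤m , ⋂-meetBelow g is _ m (m≤n+m (strictBound is) N) m∈g

module Classical (lem : ExcludedMiddle (suc 0ℓ)) where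

  dec : (P : Set) → Dec P
  dec P = map′ lower lift lem

  choose : ∀ {a b} {A : Set a} {P : A → Set b} → A → Dec (Σ A P) → A
  choose _ (yes (a , _)) = a
  choose a (no _)        = a

  choose-spec : ∀ {a b} {A : Set a} {P : A → Set b} x (d : Dec (Σ A P)) → Σ A P → P (choose x d)
  choose-spec _ (yes (_ , pa)) _ = pa
  choose-spec _ (no ¬∃)        ∃ = ⊥-elim (¬∃ ∃)

  ¬⊆⇒∃∖ : ∀ {A B} → ¬ (A ⊆ B) → Σ ℕ λ m → A m × ¬ B m
  ¬⊆⇒∃∖ {A} {B} A⊈B with dec (Σ ℕ λ m → A m × ¬ B m)
  ... | yes ∃∖ = ∃∖
  ... | no ¬∃∖ = ⊥-elim (A⊈B A⊆B)
    where
    A⊆B : A ⊆ B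
    A⊆B m Am with dec (B m)
    ... | yes Bm = Bm
    ... | no ¬Bm = ⊥-elim (¬∃∖ (m , Am , ¬Bm))

module Games (lem : ExcludedMiddle (suc 0ℓ)) (F : Family) (isF : IsFilter F) where
  open IsFilter isF
  open Classical lem

  Tail∈F : ∀ N → F (Tail N)
  Tail∈F N = cofinite⊆ _ (N , λ _ N≤m → N≤m)

  ∩Tail∈F : ∀ {Y} N → F Y → F (Y ∩ Tail N)
  ∩Tail∈F N Y∈F = ∩-closed _ _ Y∈F (Tail∈F N)

  meetBelow∈F : ∀ g → (∀ i → F (g i)) → ∀ k → F (meetBelow g k)
  meetBelow∈F g g∈F zero   = ⊇-closed _ _ (λ _ _ → z≤n , λ _ ()) (Tail∈F 0)
  meetBelow∈F g g∈F (1+ k) =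
    ⊇-closed _ _ (λ { m ((m∈gₖ , m∈gk) , k<m) → k<m , below m m∈gₖ m∈gk })
      (∩Tail∈F (1+ k) (∩-closed _ _ (meetBelow∈F g g∈F k) (g∈F k)))
    where
    below : ∀ m → meetBelow g k m → g k m → ∀ i → i < 1+ k → g i m
    below m (_ , m∈g<k) m∈gk i i<1+k with m<1+n⇒m<n∨m≡n i<1+k
    ... | inj₁ i<k  = m∈g<k i i<k
    ... | inj₂ refl = m∈gk

  IWinsFinite⇒IWinsPoints : IWinsFinite F → IWinsPoints F
  IWinsFinite⇒IWinsPoints (σ , σ∈F , σ-wins) =
    σ ∘ map singleton , (λ _ → σ∈F _) , λ n legal →
      Plus-mono (⋃-singleton n) (σ-wins (singleton ∘ n) λ k →
        tt , subst (λ h → σ h (n k)) (sym (prefixL-∘ singleton n k)) (legal k) ∷ [])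

  IWinsPoints⇒CountablyGenerated : IWinsPoints F → CountablyGenerated F
  IWinsPoints⇒CountablyGenerated (σ , σ∈F , σ-wins) = σ ∘ decode , (λ _ → σ∈F _) , generates
    where
    Generated : Subset → Set₁
    Generated Y = Σ (List ℕ) λ is → Σ Subset λ C → Cofinite C × ((C ∩ ⋂ (σ ∘ decode) is) ⊆ Y)
    generates : ∀ Y → F Y → Generated Y
    generates Y Y∈F with lem {Generated Y}
    ... | yes gen = gen
    ... | no ¬gen = ⊥-elim escapes
      where
      σ⊈Y : ∀ h → ¬ (σ h ⊆ Y)
      σ⊈Y h σh⊆Y = ¬gen (code h ∷ [] , (λ _ → ⊤) , (0 , λ _ _ → tt) , λ
        { m (_ , m∈σh ∷ []) → σh⊆Y m (subst (λ h′ → σ h′ m) (decode-code h) m∈σh) })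
      escape : ∀ h → Σ ℕ λ m → σ h m × ¬ Y m
      escape h = ¬⊆⇒∃∖ (σ⊈Y h)
      ρ : List ℕ → ℕ
      ρ = proj₁ ∘ escape
      escapes : ⊥
      escapes with σ-wins (ρ ∘ history ρ)
        (λ k → subst (λ h → σ h (ρ (history ρ k))) (sym (prefixℕ-history ρ k))
                     (proj₁ (proj₂ (escape (history ρ k)))))
        Y Y∈F 0
      ... | m , _ , (k , ρk≡m) , Ym = proj₂ (proj₂ (escape (history ρ k))) (subst Y (sym ρk≡m) Ym)

  CountablyGenerated⇒IWinsFinite : CountablyGenerated F → IWinsFinite F
  CountablyGenerated⇒IWinsFinite (g , g∈F , generates) =
    meetBelow g ∘ length , (λ _ → meetBelow∈F g g∈F _) , wins
    where
    wins : ∀ s → (∀ k → NonEmpty (s k) × All (meetBelow g (length (prefixL s k))) (s k)) →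
           Plus F (⋃ s)
    wins s legal Y Y∈F N′ with generates Y Y∈F
    ... | is , C , (N , N⊆C) , C∩g⊆Y with legal (N′ + N + strictBound is)
    ... | nonEmpty , allBelow with NonEmpty-All⇒∃ _ nonEmpty allBelow
    ... | x , x∈s , x∈meet with meetBelow-⊆ g is (N′ + N) x
                                  (subst (λ j → meetBelow g j x) (length-prefixL s _) x∈meet)
    ... | N′+N≤x , x∈g =
      x , ≤-trans (m≤m+n N′ N) N′+N≤x , (_ , x∈s) ,
      C∩g⊆Y x (N⊆C x (≤-trans (m≤n+m N N′) N′+N≤x) , x∈g)

  IIWinsPoints⇒IIWinsFinite : IIWinsPoints F → IIWinsFinite F
  IIWinsPoints⇒IIWinsFinite (τ , legal , τ-wins) =
    (λ p X → singleton (τ p X)) , (λ p X p∈F X∈F → tt , legal p X p∈F X∈F ∷ []) ,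
    λ X X∈F ⋃⁺ → τ-wins X X∈F (Plus-mono (⋃-singleton _) ⋃⁺)

  ¬PlusRamsey⇒tree : ¬ PlusRamsey F →
    Σ (List ℕ → Set) λ T → PlusTree F T × (∀ b → IsBranch T b → ¬ Plus F (range b))
  ¬PlusRamsey⇒tree ¬ramsey with lem {Σ (List ℕ → Set) λ T →
                                      PlusTree F T × (∀ b → IsBranch T b → ¬ Plus F (range b))}
  ... | yes tree = tree
  ... | no ¬tree = ⊥-elim (¬ramsey ramsey)
    where
    ramsey : PlusRamsey F
    ramsey T T-tree with lem {Σ (ℕ → ℕ) λ b → IsBranch T b × Plus F (range b)}
    ... | yes branch = branch
    ... | no ¬branch = ⊥-elim (¬tree (T , T-tree , λ b b∈T b⁺ → ¬branch (b , b∈T , b⁺)))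

  module FollowTree (T : List ℕ → Set) (T-tree : PlusTree F T) where
    open PlusTree T-tree

    answer : List ℕ → Subset → ℕ
    answer s X = choose 0 (dec (Σ ℕ λ n → X n × T (s ∷ʳ n)))

    answer-spec : ∀ s X → T s → F X → X (answer s X) × T (s ∷ʳ answer s X)
    answer-spec s X s∈T X∈F with splitting s s∈T
    ... | Z , Z⁺ , Z⊆next with Z⁺ X X∈F 0
    ... | n , _ , Zn , Xn = choose-spec 0 (dec _) (n , Xn , Z⊆next n Zn)

    extend : List ℕ → Subset → List ℕ
    extend s X = s ∷ʳ answer s X

    node : List Subset → List ℕ
    node = foldl extend []

    foldl-extend∈T : ∀ s p → T s → All F p → T (foldl extend s p)
    foldl-extend∈T s []      s∈T []          = s∈T
    foldl-extend∈T s (X ∷ p) s∈T (X∈F ∷ p∈F) =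
      foldl-extend∈T (extend s X) p (proj₂ (answer-spec s X s∈T X∈F)) p∈F

    τ : List Subset → Subset → ℕ
    τ p = answer (node p)

    node-prefix : ∀ X k → node (prefix X k) ≡ prefixℕ (λ j → τ (prefix X j) (X j)) k
    node-prefix X zero   = refl
    node-prefix X (1+ k) =
      trans (foldl-∷ʳ extend [] (X k) (prefix X k)) (cong (_∷ʳ τ (prefix X k) (X k)) (node-prefix X k))

    legal : ∀ p X → All F p → F X → X (τ p X)
    legal p X p∈F X∈F = proj₁ (answer-spec (node p) X (foldl-extend∈T [] p root p∈F) X∈F)

    isBranch : ∀ X → (∀ k → F (X k)) → IsBranch T (λ k → τ (prefix X k) (X k))
    isBranch X X∈F k = subst T (node-prefix X k) (foldl-extend∈T [] _ root (All-prefix X X∈F k))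

  ¬PlusRamsey⇒IIWinsPoints : ¬ PlusRamsey F → IIWinsPoints F
  ¬PlusRamsey⇒IIWinsPoints ¬ramsey with ¬PlusRamsey⇒tree ¬ramsey
  ... | T , T-tree , no⁺branch =
    τ , legal , λ X X∈F → no⁺branch _ (isBranch X X∈F)
    where open FollowTree T T-tree

  module StrategyTree (τ : List Subset → Subset → List ℕ)
                      (legal : ∀ p X → All F p → F X → NonEmpty (τ p X) × All X (τ p X)) where

    Playable : List Subset → ℕ → Set₁
    Playable p n = Σ Subset λ X → F X × n ∈ τ p X

    move : List Subset → ℕ → Subset
    move p n = choose ∅ (lem {Playable p n})

    move-spec : ∀ p n → True (lem {Playable p n}) → F (move p n) × n ∈ τ p (move p n)
    move-spec p n n-playable = choose-spec ∅ (lem {Playable p n}) (toWitness n-playable)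

    extend : List Subset → ℕ → List Subset
    extend p n = p ∷ʳ move p n

    -- Every entry of s is a possible answer of τ, I's moves being the chosen witnesses.
    Node : List Subset → List ℕ → Set
    Node p []      = ⊤
    Node p (n ∷ s) = True (lem {Playable p n}) × Node (extend p n) s

    Node-++⁻ : ∀ p s t → Node p (s ++ t) → Node p s × Node (foldl extend p s) t
    Node-++⁻ p []      t t∈N           = tt , t∈N
    Node-++⁻ p (n ∷ s) t (n-ok , rest) with Node-++⁻ (extend p n) s t rest
    ... | s∈N , t∈N = (n-ok , s∈N) , t∈N

    Node-++⁺ : ∀ p s t → Node p s → Node (foldl extend p s) t → Node p (s ++ t)
    Node-++⁺ p []      t _            t∈N = t∈N
    Node-++⁺ p (n ∷ s) t (n-ok , s∈N) t∈N = n-ok , Node-++⁺ (extend p n) s t s∈N t∈N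

    All-moves : ∀ p s → All F p → Node p s → All F (foldl extend p s)
    All-moves p []      p∈F _            = p∈F
    All-moves p (n ∷ s) p∈F (n-ok , s∈N) =
      All-moves (extend p n) s (∷ʳ⁺ p∈F (proj₁ (move-spec p n n-ok))) s∈N

    Playable⁺ : ∀ p → All F p → Plus F (λ n → True (lem {Playable p n}))
    Playable⁺ p p∈F Y Y∈F N with legal p (Y ∩ Tail N) p∈F (∩Tail∈F N Y∈F)
    ... | nonEmpty , allIn with NonEmpty-All⇒∃ _ nonEmpty allIn
    ... | x , x∈τ , (Yx , N≤x) = x , N≤x , fromWitness (_ , ∩Tail∈F N Y∈F , x∈τ) , Yx

    tree : PlusTree F (Node [])
    tree = record
      { root       = tt
      ; initClosed = λ s t st∈N → proj₁ (Node-++⁻ [] s t st∈N)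
      ; splitting  = λ s s∈N →
          _ , Playable⁺ _ (All-moves [] s [] s∈N) , λ n n-ok → Node-++⁺ [] s (n ∷ []) s∈N (n-ok , tt)
      }

    branch⇒covered : ∀ b → IsBranch (Node []) b →
      Σ (ℕ → Subset) λ X → (∀ k → F (X k)) × (range b ⊆ ⋃ (λ k → τ (prefix X k) (X k)))
    branch⇒covered b b∈N = X , X∈F , covered
      where
      moves : ℕ → List Subset
      moves k = foldl extend [] (prefixℕ b k)
      X : ℕ → Subset
      X k = move (moves k) (b k)
      moves-prefix : ∀ k → moves k ≡ prefix X k
      moves-prefix zero   = refl
      moves-prefix (1+ k) =
        trans (foldl-∷ʳ extend [] (b k) (prefixℕ b k)) (cong (_∷ʳ X k) (moves-prefix k))
      bₖ-ok : ∀ k → True (lem {Playable (moves k) (b k)})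
      bₖ-ok k = proj₁ (proj₂ (Node-++⁻ [] (prefixℕ b k) (b k ∷ []) (b∈N (1+ k))))
      X∈F : ∀ k → F (X k)
      X∈F k = proj₁ (move-spec _ _ (bₖ-ok k))
      covered : range b ⊆ ⋃ (λ k → τ (prefix X k) (X k))
      covered m (k , bk≡m) = k , subst (λ p → m ∈ τ p (X k)) (moves-prefix k)
        (subst (_∈ τ (moves k) (X k)) bk≡m (proj₂ (move-spec _ _ (bₖ-ok k))))

  IIWinsFinite⇒¬PlusRamsey : IIWinsFinite F → ¬ PlusRamsey F
  IIWinsFinite⇒¬PlusRamsey (τ , legal , τ-wins) ramsey =
    let open StrategyTree τ legal
        b , b∈T , b⁺ = ramsey (Node []) tree
        X , X∈F , covered = branch⇒covered b b∈T
    in τ-wins X X∈F (Plus-mono covered b⁺)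

theorem2p18 : ExcludedMiddle (suc 0ℓ) →
    (F : Family) → IsFilter F →
      ((IWinsFinite F ⇔ IWinsPoints F) × (IIWinsFinite F ⇔ IIWinsPoints F))
      × (IWinsFinite F ⇔ CountablyGenerated F)
      × (IIWinsFinite F ⇔ (¬ PlusRamsey F))
theorem2p18 lem F isF =
  (mk⇔ IWinsFinite⇒IWinsPoints (CountablyGenerated⇒IWinsFinite ∘ IWinsPoints⇒CountablyGenerated) ,
   mk⇔ (¬PlusRamsey⇒IIWinsPoints ∘ IIWinsFinite⇒¬PlusRamsey) IIWinsPoints⇒IIWinsFinite) ,
  mk⇔ (IWinsPoints⇒CountablyGenerated ∘ IWinsFinite⇒IWinsPoints) CountablyGenerated⇒IWinsFinite ,
  mk⇔ IIWinsFinite⇒¬PlusRamsey (IIWinsPoints⇒IIWinsFinite ∘ ¬PlusRamsey⇒IIWinsPoints)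
  where open Games lem F isF
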